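{- Let $\mathcal{I}=(D,\mathcal{S}=(S_1,\dots, S_q),W,k)$ be an instance of r-$\mathcal{H}$-SCC Partitioned Compression and let $X$ be a solution for this instance. Let $u\in V(D)$ be a vertex such that $u\notin X$ and there is no $u$-$W$ path in $D-X$ (resp. no $W$-$u$ path in $D-X$). Then there is a solution for $\mathcal{I}$ that contains an important $\{u\}$-$W$ separator in $D$ (resp. an important $\{u\}$-$W$ separator in $D^{rev}$).
   Context: $\mathcal{H}$ is a fixed finite family of rooted digraphs. A set $X\subseteq V(D)$ is an $\mathcal{H}$-deletion set of $D$ if no strong component of $D-X$ contains a subgraph isomorphic to a graph in $\mathcal{H}$. An instance of r-$\mathcal{H}$-SCC Partitioned Compression is a tuple $(D,\mathcal{S}=(S_1,\dots,S_q),W,k)$ where $W$ is an $\mathcal{H}$-deletion set of size at most $k+1$ and $\mathcal{S}$ is an ordered partition of $W$; a solution is an $\mathcal{H}$-deletion set $X$ with $|X|\le k$, $X\cap W=\emptyset$, and $X$ intersecting all $S_i$-$S_j$ paths in $D$ for every $i<j$. An $S$-$T$ separator is a set $C$ disjoint from $S\cup T$ such that $D-C$ has no $S$-$T$ path; $C$ covers $C'$ if the set of vertices reachable from $S$ in $D-C$ contains that for $D-C'$; $C$ is important if there is no $S$-$T$ separator $C'\neq C$ with $|C'|\le|C|$ that covers $C$. $D^{rev}$ is $D$ with all arcs reversed. -}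

module Defs where

open import Data.Nat using (ℕ; suc; _≤_; _<_)
open import Data.Bool using (Bool; true)
open import Data.Fin using (Fin; toℕ)
open import Data.Fin.Subset using (Subset; _∈_; _∉_; _⊆_; ∣_∣; Nonempty; _∪_; ⁅_⁆)
open import Data.List using (List)
open import Data.List.Membership.Propositional using () renaming (_∈_ to _∈ₗ_)
open import Data.Product using (Σ; ∃; _×_; _,_)
open import Relation.Binary.PropositionalEquality using (_≡_; _≢_)
open import Relation.Nullary using (¬_)

record Digraph : Set where
  field
    size : ℕ
    arc  : Fin size → Fin size → Bool
open Digraph public

record RootedDigraph : Set where
  field
    graph : Digraph
    root  : Fin (size graph)
open RootedDigraph public

rev : Digraph → Digraph
rev D = record { size = size D ; arc = λ u v → arc D v u }

module _ (D : Digraph) where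
  private V = Fin (size D)

  data Reach (X : Subset (size D)) : V → V → Set where
    here : ∀ {v} → v ∉ X → Reach X v v
    step : ∀ {u w v} → u ∉ X → arc D u w ≡ true → Reach X w v → Reach X u v

  PathBetween : Subset (size D) → Subset (size D) → Subset (size D) → Set
  PathBetween X A B = Σ V λ a → Σ V λ b → a ∈ A × b ∈ B × Reach X a b

  ContainsInSCC : Subset (size D) → Digraph → Set
  ContainsInSCC X H =
    Σ (Fin (size H) → V) λ f →
        (∀ i j → f i ≡ f j → i ≡ j)
      × (∀ i j → arc H i j ≡ true → arc D (f i) (f j) ≡ true)
      × (∀ i → f i ∉ X)
      × (∀ i j → Reach X (f i) (f j))

  IsHDeletionSet : List RootedDigraph → Subset (size D) → Set
  IsHDeletionSet ℋ X = ∀ h → h ∈ₗ ℋ → ¬ ContainsInSCC X (graph h)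

  Disjoint : Subset (size D) → Subset (size D) → Set
  Disjoint A B = ∀ v → v ∈ A → v ∉ B

  IsSeparator : Subset (size D) → Subset (size D) → Subset (size D) → Set
  IsSeparator S T C = Disjoint C (S ∪ T) × ¬ PathBetween C S T

  ReachFrom : Subset (size D) → Subset (size D) → V → Set
  ReachFrom S C v = Σ V λ s → s ∈ S × Reach C s v

  Covers : Subset (size D) → Subset (size D) → Subset (size D) → Set
  Covers S C C' = ∀ v → ReachFrom S C' v → ReachFrom S C v

  IsImportantSeparator : Subset (size D) → Subset (size D) → Subset (size D) → Set
  IsImportantSeparator S T C =
    IsSeparator S T C ×
    (∀ C' → IsSeparator S T C' → C' ≢ C → ∣ C' ∣ ≤ ∣ C ∣ → ¬ Covers S C' C)

  record IsInstance (ℋ : List RootedDigraph) (q : ℕ) (S : Fin q → Subset (size D))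
                    (W : Subset (size D)) (k : ℕ) : Set where
    field
      W-del      : IsHDeletionSet ℋ W
      W-size     : ∣ W ∣ ≤ suc k
      parts-nonempty : ∀ i → Nonempty (S i)
      parts-disj : ∀ i j → i ≢ j → Disjoint (S i) (S j)
      parts-sub  : ∀ i → S i ⊆ W
      parts-cover : ∀ v → v ∈ W → Σ (Fin q) λ i → v ∈ S i

  IsSolution : List RootedDigraph → (q : ℕ) → (Fin q → Subset (size D)) →
               Subset (size D) → ℕ → Subset (size D) → Set
  IsSolution ℋ q S W k X =
      IsHDeletionSet ℋ X
    × ∣ X ∣ ≤ k
    × Disjoint X W
    × (∀ i j → toℕ i < toℕ j → ¬ PathBetween X (S i) (S j))

-- Let R be the set of vertices reachable from u in D − X and N ⊆ X its out-neighbourhood,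
-- a u-W separator. Pushing N yields an important u-W separator C with R ⊆ R(C) and |C| ≤ |N|,
-- and Y = C ∪ (X − N) is no larger than X. Since the out-neighbours of R(C) lie in C ⊆ Y, a walk
-- of D − Y that enters R(C) stays there and so avoids W; a walk that never enters R(C) avoids
-- X, because every vertex of N lies in R(C) or in C. The second claim is the first one in D^rev.
module Submission where

open import Defs
open import Data.Nat using (ℕ; suc; _+_; _∸_; _≤_; _<_; z≤n; s≤s; _≤?_)
open import Data.Nat.Properties
  using (≤-refl; ≤-trans; ≤-reflexive; +-suc; +-monoˡ-≤; m≤n⇒m≤1+n; ∸-monoʳ-<; ≤⇒≯; ≰⇒>)
open import Data.Nat.Induction using (<-wellFounded)
open import Induction.WellFounded using (Acc; acc)
open import Data.Bool using (true)
open import Data.Bool.Properties using (T-≡) renaming (_≟_ to _≟ᵇ_)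
open import Data.Fin using (Fin; toℕ)
open import Data.Fin.Properties using (any?; all?) renaming (_≟_ to _≟ᶠ_)
open import Data.Fin.Subset
open import Data.Fin.Subset.Properties
open import Data.Vec using (tabulate; _∷_; [])
open import Data.Vec.Properties using (lookup∘tabulate; []=⇒lookup; lookup⇒[]=; ≡-dec)
open import Data.List using (List)
open import Data.Product using (Σ; ∃; ∃₂; _×_; _,_; proj₁; proj₂)
open import Data.Sum using (_⊎_; inj₁; inj₂; [_,_])
open import Function using (_∘_)
open import Function.Bundles using (Equivalence)
open import Relation.Binary.PropositionalEquality using (_≡_; _≢_; refl; sym; trans; cong; subst)
open import Relation.Nullary using (¬_; Dec; yes; no; contradiction)
open import Relation.Nullary.Decidable using (_×-dec_; ¬?; isYes; toWitness; fromWitness)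
open import Relation.Unary using (Pred; Decidable)

module _ {n ℓ} {P : Pred (Fin n) ℓ} (P? : Decidable P) where

  subset : Subset n
  subset = tabulate (λ x → isYes (P? x))

  ∈subset⁺ : ∀ {x} → P x → x ∈ subset
  ∈subset⁺ {x} px =
    lookup⇒[]= x subset (trans (lookup∘tabulate _ x) (Equivalence.to T-≡ (fromWitness {a? = P? x} px)))

  ∈subset⁻ : ∀ {x} → x ∈ subset → P x
  ∈subset⁻ {x} x∈ =
    toWitness {a? = P? x} (Equivalence.from T-≡ (trans (sym (lookup∘tabulate _ x)) ([]=⇒lookup x∈)))

module _ {n : ℕ} where

  x∉p∧x∉q⇒x∉p∪q : ∀ {p q : Subset n} {x} → x ∉ p → x ∉ q → x ∉ p ∪ q
  x∉p∧x∉q⇒x∉p∪q {p} {q} x∉p x∉q = [ x∉p , x∉q ] ∘ x∈p∪q⁻ p q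

  x∉p⇒∣p∣<∣p∪⁅x⁆∣ : ∀ {p : Subset n} {x} → x ∉ p → ∣ p ∣ < ∣ p ∪ ⁅ x ⁆ ∣
  x∉p⇒∣p∣<∣p∪⁅x⁆∣ {p} {x} x∉p = p⊂q⇒∣p∣<∣q∣ (p⊆p∪q ⁅ x ⁆ , x , q⊆p∪q p ⁅ x ⁆ (x∈⁅x⁆ x) , x∉p)

  p⊆q∧∣q∣≤∣p∣⇒p≡q : ∀ {p q : Subset n} → p ⊆ q → ∣ q ∣ ≤ ∣ p ∣ → p ≡ q
  p⊆q∧∣q∣≤∣p∣⇒p≡q {p} {q} p⊆q ∣q∣≤∣p∣ = ⊆-antisym p⊆q q⊆p
    where
    q⊆p : q ⊆ p
    q⊆p {x} x∈q with x ∈? p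
    ... | yes x∈p = x∈p
    ... | no x∉p  = contradiction (p⊂q⇒∣p∣<∣q∣ (p⊆q , x , x∈q , x∉p)) (≤⇒≯ ∣q∣≤∣p∣)

∣p∪q∣≤∣p∣+∣q∣ : ∀ {n} (p q : Subset n) → ∣ p ∪ q ∣ ≤ ∣ p ∣ + ∣ q ∣
∣p∪q∣≤∣p∣+∣q∣ []            []            = z≤n
∣p∪q∣≤∣p∣+∣q∣ (inside  ∷ p) (inside  ∷ q) =
  s≤s (≤-trans (m≤n⇒m≤1+n (∣p∪q∣≤∣p∣+∣q∣ p q)) (≤-reflexive (sym (+-suc ∣ p ∣ ∣ q ∣))))
∣p∪q∣≤∣p∣+∣q∣ (inside  ∷ p) (outside ∷ q) = s≤s (∣p∪q∣≤∣p∣+∣q∣ p q)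
∣p∪q∣≤∣p∣+∣q∣ (outside ∷ p) (inside  ∷ q) =
  subst (suc ∣ p ∪ q ∣ ≤_) (sym (+-suc ∣ p ∣ ∣ q ∣)) (s≤s (∣p∪q∣≤∣p∣+∣q∣ p q))
∣p∪q∣≤∣p∣+∣q∣ (outside ∷ p) (outside ∷ q) = ∣p∪q∣≤∣p∣+∣q∣ p q

q⊆p⇒∣q∣+∣p─q∣≤∣p∣ : ∀ {n} (p q : Subset n) → q ⊆ p → ∣ q ∣ + ∣ p ─ q ∣ ≤ ∣ p ∣
q⊆p⇒∣q∣+∣p─q∣≤∣p∣ []            []            _   = z≤n
q⊆p⇒∣q∣+∣p─q∣≤∣p∣ (inside  ∷ p) (inside  ∷ q) q⊆p = s≤s (q⊆p⇒∣q∣+∣p─q∣≤∣p∣ p q (drop-∷-⊆ q⊆p))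
q⊆p⇒∣q∣+∣p─q∣≤∣p∣ (inside  ∷ p) (outside ∷ q) q⊆p =
  subst (_≤ suc ∣ p ∣) (sym (+-suc ∣ q ∣ ∣ p ─ q ∣)) (s≤s (q⊆p⇒∣q∣+∣p─q∣≤∣p∣ p q (drop-∷-⊆ q⊆p)))
q⊆p⇒∣q∣+∣p─q∣≤∣p∣ (outside ∷ p) (inside  ∷ q) q⊆p = contradiction (q⊆p Data.Vec.here) λ ()
q⊆p⇒∣q∣+∣p─q∣≤∣p∣ (outside ∷ p) (outside ∷ q) q⊆p = q⊆p⇒∣q∣+∣p─q∣≤∣p∣ p q (drop-∷-⊆ q⊆p)

module _ {D : Digraph} where

  source∉ : ∀ {X a b} → Reach D X a b → a ∉ X
  source∉ (here a∉X)     = a∉X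
  source∉ (step a∉X _ _) = a∉X

  target∉ : ∀ {X a b} → Reach D X a b → b ∉ X
  target∉ (here b∉X)   = b∉X
  target∉ (step _ _ r) = target∉ r

  Reach-anti : ∀ {X Y} → X ⊆ Y → ∀ {a b} → Reach D Y a b → Reach D X a b
  Reach-anti X⊆Y (here b∉Y)     = here (b∉Y ∘ X⊆Y)
  Reach-anti X⊆Y (step a∉Y e r) = step (a∉Y ∘ X⊆Y) e (Reach-anti X⊆Y r)

  Reach-snoc : ∀ {X a v w} → Reach D X a v → arc D v w ≡ true → w ∉ X → Reach D X a w
  Reach-snoc (here v∉X)      e w∉X = step v∉X e (here w∉X)
  Reach-snoc (step a∉X e′ r) e w∉X = step a∉X e′ (Reach-snoc r e w∉X)

  Reach-rev : ∀ {X a b} → Reach (rev D) X a b → Reach D X b a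
  Reach-rev (here a∉X)     = here a∉X
  Reach-rev (step a∉X e r) = Reach-snoc (Reach-rev r) e a∉X

  PathBetween-rev : ∀ {X A B} → PathBetween (rev D) X A B → PathBetween D X B A
  PathBetween-rev (a , b , a∈A , b∈B , r) = b , a , b∈B , a∈A , Reach-rev r

  Reach-lastExit : ∀ {X x b} a → a ≢ b → Reach D X x b →
    Reach D (X ∪ ⁅ a ⁆) x b ⊎ ∃ λ w → arc D a w ≡ true × Reach D (X ∪ ⁅ a ⁆) w b
  Reach-lastExit a a≢b (here b∉X) =
    inj₁ (here (x∉p∧x∉q⇒x∉p∪q b∉X (a≢b ∘ sym ∘ x∈⁅y⁆⇒x≡y a)))
  Reach-lastExit {x = x} a a≢b (step {w = w} x∉X e r) with Reach-lastExit a a≢b r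
  ... | inj₂ exit = inj₂ exit
  ... | inj₁ r′ with x ≟ᶠ a
  ...   | yes refl = inj₂ (w , e , r′)
  ...   | no x≢a   = inj₁ (step (x∉p∧x∉q⇒x∉p∪q x∉X (x≢a ∘ x∈⁅y⁆⇒x≡y a)) e r′)

Reach? : ∀ D X a b → Dec (Reach D X a b)
Reach? D X = go X (<-wellFounded (size D ∸ ∣ X ∣))
  where
  go : ∀ X → Acc _<_ (size D ∸ ∣ X ∣) → ∀ a b → Dec (Reach D X a b)
  go X _ a b with a ∈? X | a ≟ᶠ b
  ... | yes a∈X | _        = no λ r → source∉ r a∈X
  ... | no a∉X  | yes refl = yes (here a∉X)
  go X (acc rs) a b | no a∉X | no a≢b
    with any? (λ w → (arc D a w ≟ᵇ true) ×-dec
                     go (X ∪ ⁅ a ⁆) (rs (∸-monoʳ-< (x∉p⇒∣p∣<∣p∪⁅x⁆∣ a∉X) (∣p∣≤n (X ∪ ⁅ a ⁆)))) w b)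
  ... | yes (w , e , r) = yes (step a∉X e (Reach-anti (p⊆p∪q ⁅ a ⁆) r))
  ... | no ¬exit = no λ r →
        [ (λ r′ → source∉ r′ (q⊆p∪q X ⁅ a ⁆ (x∈⁅x⁆ a))) , ¬exit ] (Reach-lastExit a a≢b r)

PathBetween? : ∀ D X A B → Dec (PathBetween D X A B)
PathBetween? D X A B = any? λ a → any? λ b → (a ∈? A) ×-dec (b ∈? B) ×-dec Reach? D X a b

Disjoint? : ∀ D A B → Dec (Disjoint D A B)
Disjoint? D A B with all? (λ v → ¬? ((v ∈? A) ×-dec (v ∈? B)))
... | yes none = yes λ v v∈A v∈B → none v (v∈A , v∈B)
... | no some  = no λ disj → some λ v (v∈A , v∈B) → disj v v∈A v∈B

OutClosed : (D : Digraph) → Subset (size D) → Subset (size D) → Set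
OutClosed D Y R = ∀ {x w} → x ∈ R → arc D x w ≡ true → w ∉ Y → w ∈ R

module _ {D : Digraph} {Y R : Subset (size D)} (closed : OutClosed D Y R) where

  Reach-inside : ∀ {x v} → x ∈ R → Reach D Y x v → Reach D (∁ R) x v
  Reach-inside x∈R (here _)     = here (x∈p⇒x∉∁p x∈R)
  Reach-inside x∈R (step _ e r) = step (x∈p⇒x∉∁p x∈R) e (Reach-inside (closed x∈R e (source∉ r)) r)

  Reach-stays : ∀ {x v} → x ∈ R → Reach D Y x v → v ∈ R
  Reach-stays x∈R r = x∉∁p⇒x∈p (target∉ (Reach-inside x∈R r))

  Reach-outside : ∀ {x v} → Reach D Y x v → v ∉ R → Reach D (Y ∪ R) x v
  Reach-outside (here x∉Y) x∉R = here (x∉p∧x∉q⇒x∉p∪q x∉Y x∉R)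
  Reach-outside r@(step x∉Y e r′) v∉R =
    step (x∉p∧x∉q⇒x∉p∪q x∉Y (v∉R ∘ λ x∈R → Reach-stays x∈R r)) e (Reach-outside r′ v∉R)

SameStrongComponent : (D : Digraph) → Subset (size D) → ∀ {m} → (Fin m → Fin (size D)) → Set
SameStrongComponent D X f = ∀ i j → Reach D X (f i) (f j)

-- Whatever a solution must avoid in D − Y (W-W paths, patterns inside one strong component)
-- already occurs in D − X or in D − W, so Y is a solution whenever X is.
record Replaces (D : Digraph) (W X Y : Subset (size D)) : Set where
  field
    disjoint : Disjoint D Y W
    size≤    : ∣ Y ∣ ≤ ∣ X ∣
    W-paths  : ∀ {a b} → a ∈ W → b ∈ W → Reach D Y a b → Reach D X a b
    strong   : ∀ {m} (f : Fin m → Fin (size D)) → SameStrongComponent D Y f →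
               SameStrongComponent D X f ⊎ SameStrongComponent D W f

Replaces-rev : ∀ {D W X Y} → Replaces (rev D) W X Y → Replaces D W X Y
-- rev (rev D) is D up to η, so Reach-rev {D = rev D} turns walks of D into walks of rev D.
Replaces-rev {D} rep = record
  { disjoint = disjoint
  ; size≤    = size≤
  ; W-paths  = λ a∈W b∈W → Reach-rev ∘ W-paths b∈W a∈W ∘ Reach-rev {D = rev D}
  ; strong   = λ f sc → Data.Sum.map unrev unrev (strong f λ i j → Reach-rev {D = rev D} (sc j i))
  }
  where
  open Replaces rep
  unrev : ∀ {Z m} {f : Fin m → Fin (size D)} →
          SameStrongComponent (rev D) Z f → SameStrongComponent D Z f
  unrev sc i j = Reach-rev (sc j i)

Replaces-isSolution : ∀ {ℋ D q S W k X Y} → IsInstance D ℋ q S W k →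
  IsSolution D ℋ q S W k X → Replaces D W X Y → IsSolution D ℋ q S W k Y
Replaces-isSolution {ℋ} {D} {q} {S} {Y = Y} inst (X-del , ∣X∣≤k , _ , X-sep) rep =
  Y-del , ≤-trans size≤ ∣X∣≤k , disjoint , Y-sep
  where
  open IsInstance inst
  open Replaces rep

  Y-del : IsHDeletionSet D ℋ Y
  Y-del h h∈ℋ (f , inj , hom , _ , sc) with strong f sc
  ... | inj₁ scX = X-del h h∈ℋ (f , inj , hom , (λ i → source∉ (scX i i)) , scX)
  ... | inj₂ scW = W-del h h∈ℋ (f , inj , hom , (λ i → source∉ (scW i i)) , scW)

  Y-sep : ∀ i j → toℕ i < toℕ j → ¬ PathBetween D Y (S i) (S j)
  Y-sep i j i<j (a , b , a∈ , b∈ , r) =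
    X-sep i j i<j (a , b , a∈ , b∈ , W-paths (parts-sub i a∈) (parts-sub j b∈) r)

module Separation (D : Digraph) (u : Fin (size D)) (W : Subset (size D)) where

  private
    n = size D

  Separator : Subset n → Set
  Separator = IsSeparator D ⁅ u ⁆ W

  reachable : Subset n → Subset n
  reachable C = subset (Reach? D C u)

  ∈reachable⁺ : ∀ {C v} → Reach D C u v → v ∈ reachable C
  ∈reachable⁺ = ∈subset⁺ (Reach? D _ u)

  ∈reachable⁻ : ∀ {C v} → v ∈ reachable C → Reach D C u v
  ∈reachable⁻ = ∈subset⁻ (Reach? D _ u)

  reachable-closed : ∀ {C} → OutClosed D C (reachable C)
  reachable-closed x∈R e w∉C = ∈reachable⁺ (Reach-snoc (∈reachable⁻ x∈R) e w∉C)

  OutNeighbour : Subset n → Fin n → Set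
  OutNeighbour R w = w ∉ R × ∃ λ v → v ∈ R × arc D v w ≡ true

  outBoundary : Subset n → Subset n
  outBoundary R = subset {P = OutNeighbour R} λ w →
    ¬? (w ∈? R) ×-dec any? λ v → (v ∈? R) ×-dec (arc D v w ≟ᵇ true)

  outBoundary-closed : ∀ {R} → OutClosed D (outBoundary R) R
  outBoundary-closed {R} {w = w} x∈R e w∉N with w ∈? R
  ... | yes w∈R = w∈R
  ... | no w∉R  = contradiction (∈subset⁺ _ (w∉R , _ , x∈R , e)) w∉N

  outBoundary-reachable⊆ : ∀ {C} → outBoundary (reachable C) ⊆ C
  outBoundary-reachable⊆ {C} {w} w∈N with w ∈? C | ∈subset⁻ _ w∈N
  ... | yes w∈C | _                    = w∈C
  ... | no w∉C  | (w∉R , _ , v∈R , e) = contradiction (reachable-closed v∈R e w∉C) w∉R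

  reachable-outBoundary : ∀ {C} → u ∉ C → reachable (outBoundary (reachable C)) ≡ reachable C
  reachable-outBoundary {C} u∉C = ⊆-antisym
    (λ v∈R′ → Reach-stays outBoundary-closed (∈reachable⁺ (here u∉C)) (∈reachable⁻ v∈R′))
    (λ v∈R → ∈reachable⁺ (Reach-anti outBoundary-reachable⊆ (∈reachable⁻ v∈R)))

  Separator? : ∀ C → Dec (Separator C)
  Separator? C = Disjoint? D C (⁅ u ⁆ ∪ W) ×-dec ¬? (PathBetween? D C ⁅ u ⁆ W)

  separator⁺ : ∀ {C} → Disjoint D C (⁅ u ⁆ ∪ W) → (∀ {v} → v ∈ W → v ∉ reachable C) → Separator C
  separator⁺ disj W∩R=∅ = disj , λ (a , b , a∈⁅u⁆ , b∈W , r) →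
    W∩R=∅ b∈W (∈reachable⁺ (subst (λ a → Reach D _ a b) (x∈⁅y⁆⇒x≡y u a∈⁅u⁆) r))

  module _ {C} (sep : Separator C) where

    u∉separator : u ∉ C
    u∉separator u∈C = proj₁ sep u u∈C (p⊆p∪q W (x∈⁅x⁆ u))

    separator∩W : ∀ {z} → z ∈ C → z ∉ W
    separator∩W z∈C z∈W = proj₁ sep _ z∈C (q⊆p∪q ⁅ u ⁆ W z∈W)

    W∩reachable : ∀ {v} → v ∈ W → v ∉ reachable C
    W∩reachable v∈W v∈R = proj₂ sep (u , _ , x∈⁅x⁆ u , v∈W , ∈reachable⁻ v∈R)

    outBoundary-separator : Separator (outBoundary (reachable C))
    outBoundary-separator = separator⁺
      (λ v v∈N → proj₁ sep v (outBoundary-reachable⊆ v∈N))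
      (λ v∈W → W∩reachable v∈W ∘ subst (_ ∈_) (reachable-outBoundary u∉separator))

  covers⇒reachable⊆ : ∀ {C C′} → Covers D ⁅ u ⁆ C′ C → reachable C ⊆ reachable C′
  covers⇒reachable⊆ cov {v} v∈R with cov v (u , x∈⁅x⁆ u , ∈reachable⁻ v∈R)
  ... | s , s∈⁅u⁆ , r = ∈reachable⁺ (subst (λ s → Reach D _ s v) (x∈⁅y⁆⇒x≡y u s∈⁅u⁆) r)

  -- The separator C is determined by its reachable set when C = outBoundary (reachable C).
  reachable-grows : ∀ {C C′} → C ⊆ outBoundary (reachable C) → C′ ≢ C → ∣ C′ ∣ ≤ ∣ C ∣ →
    reachable C ⊆ reachable C′ → ∣ reachable C ∣ < ∣ reachable C′ ∣
  reachable-grows {C} {C′} tight C′≢C ∣C′∣≤∣C∣ R⊆R′ with ∣ reachable C′ ∣ ≤? ∣ reachable C ∣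
  ... | no ∣R′∣≰∣R∣ = ≰⇒> ∣R′∣≰∣R∣
  ... | yes ∣R′∣≤∣R∣ = contradiction (sym (p⊆q∧∣q∣≤∣p∣⇒p≡q C⊆C′ ∣C′∣≤∣C∣)) C′≢C
    where
    C⊆C′ : C ⊆ C′
    C⊆C′ = outBoundary-reachable⊆
         ∘ subst (λ R → _ ∈ outBoundary R) (p⊆q∧∣q∣≤∣p∣⇒p≡q R⊆R′ ∣R′∣≤∣R∣) ∘ tight

  outBoundary-tight : ∀ {C} → u ∉ C →
    outBoundary (reachable C) ⊆ outBoundary (reachable (outBoundary (reachable C)))
  outBoundary-tight u∉C = ⊆-reflexive (cong outBoundary (sym (reachable-outBoundary u∉C)))

  ImportantAbove : Subset n → Set
  ImportantAbove C =
    ∃ λ C* → IsImportantSeparator D ⁅ u ⁆ W C* × reachable C ⊆ reachable C* × ∣ C* ∣ ≤ ∣ C ∣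

  ImportantAbove-mono : ∀ {C C′} → reachable C ⊆ reachable C′ → ∣ C′ ∣ ≤ ∣ C ∣ →
    ImportantAbove C′ → ImportantAbove C
  ImportantAbove-mono R⊆R′ ∣C′∣≤∣C∣ (C* , imp , R′⊆R* , ∣C*∣≤∣C′∣) =
    C* , imp , R′⊆R* ∘ R⊆R′ , ≤-trans ∣C*∣≤∣C′∣ ∣C′∣≤∣C∣

  ImportantAbove-outBoundary : ∀ {C} → u ∉ C →
    ImportantAbove (outBoundary (reachable C)) → ImportantAbove C
  ImportantAbove-outBoundary u∉C = ImportantAbove-mono
    (⊆-reflexive (sym (reachable-outBoundary u∉C))) (p⊆q⇒∣p∣≤∣q∣ outBoundary-reachable⊆)

  Improves : Subset n → Subset n → Set
  Improves C C′ = Separator C′ × C′ ≢ C × ∣ C′ ∣ ≤ ∣ C ∣ × reachable C ⊆ reachable C′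

  Improves? : ∀ C C′ → Dec (Improves C C′)
  Improves? C C′ = Separator? C′ ×-dec ¬? (≡-dec _≟ᵇ_ C′ C) ×-dec (∣ C′ ∣ ≤? ∣ C ∣)
                   ×-dec (reachable C ⊆? reachable C′)

  -- Replace C by a tightened improvement as long as one exists; the reachable set strictly grows.
  important-above-tight : ∀ C → Acc _<_ (n ∸ ∣ reachable C ∣) → Separator C →
    C ⊆ outBoundary (reachable C) → ImportantAbove C
  important-above-tight C (acc rs) sep tight with anySubset? (Improves? C)
  ... | no none = C , (sep , λ C′ sep′ C′≢C ∣C′∣≤∣C∣ cov →
                    none (C′ , sep′ , C′≢C , ∣C′∣≤∣C∣ , covers⇒reachable⊆ cov)) , ⊆-refl , ≤-refl
  ... | yes (C′ , sep′ , C′≢C , ∣C′∣≤∣C∣ , R⊆R′) =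
    ImportantAbove-mono R⊆R′ ∣C′∣≤∣C∣ (ImportantAbove-outBoundary (u∉separator sep′)
      (important-above-tight (outBoundary R′) (rs decreasing) (outBoundary-separator sep′)
        (outBoundary-tight (u∉separator sep′))))
    where
    R′ = reachable C′
    R′≡ : reachable (outBoundary R′) ≡ R′
    R′≡ = reachable-outBoundary (u∉separator sep′)
    decreasing : n ∸ ∣ reachable (outBoundary R′) ∣ < n ∸ ∣ reachable C ∣
    decreasing = subst (λ R → n ∸ ∣ R ∣ < n ∸ ∣ reachable C ∣) (sym R′≡)
      (∸-monoʳ-< (reachable-grows tight C′≢C ∣C′∣≤∣C∣ R⊆R′) (∣p∣≤n R′))

  important-above : ∀ {C} → Separator C → ImportantAbove C
  important-above sep = ImportantAbove-outBoundary (u∉separator sep)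
    (important-above-tight _ (<-wellFounded _) (outBoundary-separator sep)
      (outBoundary-tight (u∉separator sep)))

  exchange : Subset n → Subset n → Subset n
  exchange X C = C ∪ (X ─ outBoundary (reachable X))

  module Exchange {X C} (X∩W : Disjoint D X W) (sep : Separator C)
    (RX⊆RC : reachable X ⊆ reachable C) (∣C∣≤∣N∣ : ∣ C ∣ ≤ ∣ outBoundary (reachable X) ∣) where

    private
      N  = outBoundary (reachable X)
      Y  = exchange X C
      RC = reachable C

    Y-closed : OutClosed D Y RC
    Y-closed x∈RC e w∉Y = reachable-closed x∈RC e (w∉Y ∘ p⊆p∪q (X ─ N))

    X⊆Y∪RC : X ⊆ Y ∪ RC
    X⊆Y∪RC {z} z∈X with z ∈? N
    ... | no z∉N = p⊆p∪q RC (q⊆p∪q C (X ─ N) (x∈p∧x∉q⇒x∈p─q z∈X z∉N))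
    ... | yes z∈N with z ∈? C | ∈subset⁻ _ z∈N
    ...   | yes z∈C | _                  = p⊆p∪q RC (p⊆p∪q (X ─ N) z∈C)
    ...   | no z∉C  | (_ , _ , v∈RX , e) = q⊆p∪q Y RC (reachable-closed (RX⊆RC v∈RX) e z∉C)

    W⊆∁RC : W ⊆ ∁ RC
    W⊆∁RC = x∉p⇒x∈∁p ∘ W∩reachable sep

    replaces : Replaces D W X Y
    replaces = record
      { disjoint = λ z z∈Y → [ separator∩W sep , X∩W z ∘ p─q⊆p X N ] (x∈p∪q⁻ C (X ─ N) z∈Y)
      ; size≤    = ≤-trans (∣p∪q∣≤∣p∣+∣q∣ C (X ─ N))
                     (≤-trans (+-monoˡ-≤ ∣ X ─ N ∣ ∣C∣≤∣N∣) (q⊆p⇒∣q∣+∣p─q∣≤∣p∣ X N outBoundary-reachable⊆))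
      ; W-paths  = λ _ b∈W r → Reach-anti X⊆Y∪RC (Reach-outside Y-closed r (W∩reachable sep b∈W))
      ; strong   = strong
      }
      where
      strong : ∀ {m} (f : Fin m → Fin n) → SameStrongComponent D Y f →
               SameStrongComponent D X f ⊎ SameStrongComponent D W f
      strong f sc with any? (λ i → f i ∈? RC)
      ... | yes (i , fi∈RC) = inj₂ λ j k →
            Reach-anti W⊆∁RC (Reach-inside Y-closed (Reach-stays Y-closed fi∈RC (sc i j)) (sc j k))
      ... | no none = inj₁ λ j k → Reach-anti X⊆Y∪RC (Reach-outside Y-closed (sc j k) (none ∘ (k ,_)))

  important-replacement : ∀ {X} → u ∉ X → Disjoint D X W → ¬ PathBetween D X ⁅ u ⁆ W →
    ∃₂ λ Y C → C ⊆ Y × IsImportantSeparator D ⁅ u ⁆ W C × Replaces D W X Y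
  important-replacement {X} u∉X X∩W no-path = replacement (important-above (outBoundary-separator sepX))
    where
    sepX : Separator X
    sepX = (λ z z∈X → [ (λ z∈⁅u⁆ → u∉X (subst (_∈ X) (x∈⁅y⁆⇒x≡y u z∈⁅u⁆) z∈X)) , X∩W z z∈X ]
                        ∘ x∈p∪q⁻ ⁅ u ⁆ W)
         , no-path
    replacement : ImportantAbove (outBoundary (reachable X)) →
      ∃₂ λ Y C → C ⊆ Y × IsImportantSeparator D ⁅ u ⁆ W C × Replaces D W X Y
    replacement (C , imp , RN⊆RC , ∣C∣≤∣N∣) = exchange X C , C , p⊆p∪q _ , imp ,
      Exchange.replaces X∩W (proj₁ imp) (RN⊆RC ∘ ⊆-reflexive (sym (reachable-outBoundary u∉X))) ∣C∣≤∣N∣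

lemma12 : (ℋ : List RootedDigraph) (D : Digraph) (q : ℕ) (S : Fin q → Subset (size D))
          (W : Subset (size D)) (k : ℕ) → IsInstance D ℋ q S W k →
          (X : Subset (size D)) → IsSolution D ℋ q S W k X →
          (u : Fin (size D)) → u ∉ X →
            ((¬ PathBetween D X ⁅ u ⁆ W) →
               Σ (Subset (size D)) λ Y → IsSolution D ℋ q S W k Y ×
                 Σ (Subset (size D)) λ C → C ⊆ Y × IsImportantSeparator D ⁅ u ⁆ W C)
          × ((¬ PathBetween D X W ⁅ u ⁆) →
               Σ (Subset (size D)) λ Y → IsSolution D ℋ q S W k Y ×
                 Σ (Subset (size D)) λ C → C ⊆ Y × IsImportantSeparator (rev D) ⁅ u ⁆ W C)
lemma12 ℋ D q S W k inst X solX u u∉X =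
    (λ no-path →
       let Y , C , C⊆Y , imp , rep = Separation.important-replacement D u W u∉X X∩W no-path
       in Y , Replaces-isSolution inst solX rep , C , C⊆Y , imp)
  , (λ no-path →
       let Y , C , C⊆Y , imp , rep =
             Separation.important-replacement (rev D) u W u∉X X∩W (no-path ∘ PathBetween-rev)
       in Y , Replaces-isSolution inst solX (Replaces-rev rep) , C , C⊆Y , imp)
  where
  X∩W : Disjoint D X W
  X∩W = proj₁ (proj₂ (proj₂ solX))
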